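{- Let $(A,W)$ be a Pratt comonoid, let $x_0\supseteq x_1\supseteq\dots$ be a descending chain of elements of $W$ indexed by $\omega$, and $y_0\subseteq y_1\subseteq\dots$ an ascending chain of elements of $W$ indexed by $\omega$. Suppose $\bigcap_{m\in\omega}x_m=\emptyset$, and that for no pair $(m,n)\in\omega\times\omega$ does $y_n$ contain $x_m\cap\bigcup_{i\in\omega}y_i$. Then $W$ has cardinality at least $2^{\aleph_0}$; in fact $W$ contains a complete sublattice isomorphic to the lattice of all subsets of $\omega$.
   Context: A Pratt comonoid is a pair $(A,W)$ with $A$ a set and $W$ a set of subsets of $A$ such that (i) $\emptyset\in W$ and $A\in W$; (ii) whenever $C\subseteq A\times A$ is such that for every $a\in A$ both the row $\{b\mid (a,b)\in C\}$ and the column $\{b\mid (b,a)\in C\}$ belong to $W$, the diagonal $\{b\mid (b,b)\in C\}$ also belongs to $W$. A complete sublattice of $W$ means a subset of $W$ closed under arbitrary (possibly infinite) unions and intersections taken in the power set of $A$ (not necessarily containing $\emptyset$ or $A$). -}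

module Defs where

open import Level using (0ℓ) renaming (suc to lsuc)
open import Data.Nat using (ℕ; suc)
open import Data.Product using (Σ; _×_)
open import Function.Bundles using (_⇔_)
open import Relation.Unary using (Pred; _⊆_; _≐_; ∅; U; ⋃; ⋂)

Subset : Set → Set₁
Subset A = Pred A 0ℓ

-- (A , W) is a Pratt comonoid.  Since W is a *set of subsets*, membership
-- in W must be invariant under extensional equality of subsets ('resp').
record IsPrattComonoid (A : Set) (W : Pred (Subset A) 0ℓ) : Set₁ where
  field
    resp  : ∀ {X Y : Subset A} → X ≐ Y → W X → W Y
    empty : W ∅
    full  : W U
    diag  : (C : A → A → Set) →
            (∀ a → W (λ b → C a b)) →
            (∀ a → W (λ b → C b a)) →
            W (λ b → C b b)

-- L is a complete sublattice of W: L ⊆ W and L is closed under unions and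
-- intersections (in the power set of A) of arbitrary nonempty families.
-- (Empty families are excluded: a complete sublattice need not contain ∅ or A.)
record IsCompleteSublattice {A : Set} (W : Pred (Subset A) 0ℓ)
                            (L : Pred (Subset A) (lsuc 0ℓ)) : Set₁ where
  field
    sub   : ∀ {X} → L X → W X
    ⋃-closed : (I : Set) → I → (F : I → Subset A) →
               (∀ i → L (F i)) → L (⋃ I F)
    ⋂-closed : (I : Set) → I → (F : I → Subset A) →
               (∀ i → L (F i)) → L (⋂ I F)

record IsoToPowersetω {A : Set} (L : Pred (Subset A) (lsuc 0ℓ)) : Set₂ where
  field
    f        : Subset ℕ → Subset A
    into     : ∀ S → L (f S)
    onto     : ∀ X → L X → Σ (Subset ℕ) (λ S → X ≐ f S)
    order    : ∀ S T → (S ⊆ T) ⇔ (f S ⊆ f T)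

DescendingChain : {A : Set} → (ℕ → Subset A) → Set
DescendingChain x = ∀ m → x (suc m) ⊆ x m

AscendingChain : {A : Set} → (ℕ → Subset A) → Set
AscendingChain y = ∀ m → y m ⊆ y (suc m)

-- Along subsequences X k = x (ix (k+1)) and Y k = y (iy k) of the two chains
-- there are points b k with b k ∉ X k, b (k+1) ∈ X k, b k ∉ Y k and
-- b k ∈ Y (k+1).  Send S ⊆ ω to f S = ⋂ₖ (X k ∪ Y k ∪ [k ∈ S] Y (k+1)).
-- Then f S ∈ W by the diagonal axiom for C a c = ∀ k → X k a ⊎ Y⟨ S ⟩ k c:
-- the row of a is a finite intersection because a leaves the x-chain, and the
-- column of c is a finite intersection, or is contained in ⋂ X = ∅, according
-- to whether c enters the y-chain.  The point b k lies in f S exactly when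
-- k ∈ S, so f is an order embedding; and a point of f S outside X k ∪ Y k lies
-- in f T for every T containing k, so f preserves unions and intersections.
module Submission where

open import Defs
open import Level using (Level; 0ℓ) renaming (suc to lsuc)
open import Data.Nat using (ℕ; zero; suc; _≤_; _<_; _⊔_; _≤?_; _≤′_; ≤′-refl; ≤′-step; s≤s; z≤n)
open import Data.Nat.Properties using (≤⇒≤′; ≤-trans; <⇒≤; n≤1+n; n<1+n; m<n⇒m<1+n; m<1+n⇒m<n∨m≡n; m≤m⊔n; m≤n⊔m; ≰⇒>; <-cmp)
open import Data.Product using (Σ; ∃; _×_; _,_; proj₁; proj₂)
open import Data.Sum using (_⊎_; inj₁; inj₂)
open import Data.Empty using (⊥-elim)
open import Data.Unit using (tt)
open import Function.Bundles using (mk⇔)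
open import Relation.Nullary using (¬_; yes; no)
open import Relation.Binary.Definitions using (tri<; tri≈; tri>)
open import Relation.Binary.PropositionalEquality using (refl)
open import Relation.Unary using (Pred; _⊆_; _∩_; _∪_; _≐_; ∅; ⋃; ⋂)
open import Axiom.ExcludedMiddle using (ExcludedMiddle)
open import Axiom.DoubleNegationElimination using (em⇒dne)
open import Relation.Unary.Properties using (≐-refl; ≐-sym; ≐-trans)
open import Function.Base using (_∘_)

ascending-mono : {A : Set} {Z : ℕ → Subset A} → AscendingChain Z →
                 ∀ {m n} → m ≤ n → Z m ⊆ Z n
ascending-mono {Z = Z} asc m≤n = go (≤⇒≤′ m≤n)
  where
  go : ∀ {m n} → m ≤′ n → Z m ⊆ Z n
  go ≤′-refl        z = z
  go (≤′-step m≤′n) z = asc _ (go m≤′n z)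

descending-mono : {A : Set} {Z : ℕ → Subset A} → DescendingChain Z →
                  ∀ {m n} → m ≤ n → Z n ⊆ Z m
descending-mono {Z = Z} desc m≤n = go (≤⇒≤′ m≤n)
  where
  go : ∀ {m n} → m ≤′ n → Z n ⊆ Z m
  go ≤′-refl        z = z
  go (≤′-step m≤′n) z = go m≤′n (desc _ z)

⋃-cong : {A I : Set} {F G : I → Subset A} → (∀ i → F i ≐ G i) → ⋃ I F ≐ ⋃ I G
⋃-cong F≐G = (λ { (i , a∈) → i , proj₁ (F≐G i) a∈ }) , λ { (i , a∈) → i , proj₂ (F≐G i) a∈ }

⋂-cong : {A I : Set} {F G : I → Subset A} → (∀ i → F i ≐ G i) → ⋂ I F ≐ ⋂ I G
⋂-cong F≐G = (λ a∈ i → proj₁ (F≐G i) (a∈ i)) , λ a∈ i → proj₂ (F≐G i) (a∈ i)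

module Classical (em : ExcludedMiddle 0ℓ) where

  ¬∀⇒∃¬ : {I : Set} {P : I → Set} → ¬ (∀ i → P i) → ∃ λ i → ¬ P i
  ¬∀⇒∃¬ ¬∀ = em⇒dne em λ ¬∃ → ¬∀ λ i → em⇒dne em λ ¬Pi → ¬∃ (i , ¬Pi)

  ¬⊆⇒∃ : {A : Set} {X Z : Subset A} → ¬ (X ⊆ Z) → ∃ λ a → X a × ¬ Z a
  ¬⊆⇒∃ ¬⊆ = em⇒dne em λ ¬∃ → ¬⊆ λ {a} Xa → em⇒dne em λ ¬Za → ¬∃ (a , Xa , ¬Za)

module PrattClosure (em : ExcludedMiddle 0ℓ) {A : Set} {W : Pred (Subset A) 0ℓ}
                    (pc : IsPrattComonoid A W) where

  open IsPrattComonoid pc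

  W-const-× : (P : Set) {Z : Subset A} → W Z → W (λ a → P × Z a)
  W-const-× P wZ with em {P}
  ... | yes p = resp ((p ,_) , proj₂) wZ
  ... | no ¬p = resp ((λ ()) , λ q → ¬p (proj₁ q)) empty

  W-×-const : {Z : Subset A} → W Z → (P : Set) → W (λ a → Z a × P)
  W-×-const wZ P with em {P}
  ... | yes p = resp ((_, p) , proj₁) wZ
  ... | no ¬p = resp ((λ ()) , λ q → ¬p (proj₂ q)) empty

  W-const-⊎ : (P : Set) {Z : Subset A} → W Z → W (λ a → P ⊎ Z a)
  W-const-⊎ P wZ with em {P}
  ... | yes p = resp ((λ _ → inj₁ p) , λ _ → tt) full
  ... | no ¬p = resp (inj₂ , λ { (inj₁ p) → ⊥-elim (¬p p) ; (inj₂ z) → z }) wZ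

  W-⊎-const : {Z : Subset A} → W Z → (P : Set) → W (λ a → Z a ⊎ P)
  W-⊎-const wZ P with em {P}
  ... | yes p = resp ((λ _ → inj₂ p) , λ _ → tt) full
  ... | no ¬p = resp (inj₁ , λ { (inj₁ z) → z ; (inj₂ p) → ⊥-elim (¬p p) }) wZ

  W-∩ : {X Z : Subset A} → W X → W Z → W (X ∩ Z)
  W-∩ {X} {Z} wX wZ =
    diag (λ a c → X a × Z c) (λ a → W-const-× (X a) wZ) (λ c → W-×-const wX (Z c))

  W-⋂< : (G : ℕ → Subset A) → (∀ k → W (G k)) →
         ∀ N → W (λ a → ∀ k → k < N → G k a)
  W-⋂< G wG zero    = resp ((λ _ _ ()) , λ _ → tt) full
  W-⋂< G wG (suc N) = resp (extend , restrict) (W-∩ (W-⋂< G wG N) (wG N))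
    where
    extend : ∀ {a} → (∀ k → k < N → G k a) × G N a → ∀ k → k < suc N → G k a
    extend (below , at) k k<1+N with m<1+n⇒m<n∨m≡n k<1+N
    ... | inj₁ k<N  = below k k<N
    ... | inj₂ refl = at
    restrict : ∀ {a} → (∀ k → k < suc N → G k a) → (∀ k → k < N → G k a) × G N a
    restrict all = (λ k k<N → all k (m<n⇒m<1+n k<N)) , all N (n<1+n N)

  W-⋂-stable : (G : ℕ → Subset A) → (∀ k → W (G k)) →
               (N : ℕ) → (∀ {k} → N ≤ k → G N ⊆ G k) → W (⋂ ℕ G)
  W-⋂-stable G wG N stable = resp (extend , λ all k _ → all k) (W-⋂< G wG (suc N))
    where
    extend : ∀ {a} → (∀ k → k < suc N → G k a) → ∀ k → G k a
    extend all k with k ≤? N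
    ... | yes k≤N = all k (s≤s k≤N)
    ... | no  k≰N = stable (<⇒≤ (≰⇒> k≰N)) (all N (n<1+n N))

record SeparatingSequence {A : Set} (X Y : ℕ → Subset A) : Set where
  field
    point   : ℕ → A
    point∉X : ∀ k → ¬ X k (point k)
    point∈X : ∀ k → X k (point (suc k))
    point∉Y : ∀ k → ¬ Y k (point k)
    point∈Y : ∀ k → Y (suc k) (point k)

module Thinning (em : ExcludedMiddle 0ℓ) {A : Set} (x y : ℕ → Subset A)
                (x-descending : DescendingChain x) (y-ascending : AscendingChain y)
                (⋂x⊆∅ : ⋂ ℕ x ⊆ ∅)
                (x∩⋃y⊈y : ∀ m n → ¬ ((x m ∩ ⋃ ℕ y) ⊆ y n)) where

  open Classical em

  leaves-x : (a : A) → ∃ λ e → ¬ x e a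
  leaves-x a = ¬∀⇒∃¬ ⋂x⊆∅

  witness : (m n : ℕ) → ∃ λ a → (x m ∩ ⋃ ℕ y) a × ¬ y n a
  witness m n = ¬⊆⇒∃ (x∩⋃y⊈y m n)

  witness-point : ℕ → ℕ → A
  witness-point m n = proj₁ (witness m n)

  witness-∈x : ∀ m n → x m (witness-point m n)
  witness-∈x m n = proj₁ (proj₁ (proj₂ (witness m n)))

  witness-∉y : ∀ m n → ¬ y n (witness-point m n)
  witness-∉y m n = proj₂ (proj₂ (witness m n))

  witness-entry : ℕ → ℕ → ℕ
  witness-entry m n = proj₁ (proj₂ (proj₁ (proj₂ (witness m n))))

  witness-∈y-entry : ∀ m n → y (witness-entry m n) (witness-point m n)
  witness-∈y-entry m n = proj₂ (proj₂ (proj₁ (proj₂ (witness m n))))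

  witness-exit : ℕ → ℕ → ℕ
  witness-exit m n = proj₁ (leaves-x (witness-point m n))

  witness-∉x-exit : ∀ m n → ¬ x (witness-exit m n) (witness-point m n)
  witness-∉x-exit m n = proj₂ (leaves-x (witness-point m n))

  -- The suc keeps k ≤ ix k, so that X = x ∘ ix ∘ suc still has empty intersection.
  indices : ℕ → ℕ × ℕ
  indices zero    = 0 , 0
  indices (suc k) = suc (witness-exit m n ⊔ m) , witness-entry m n ⊔ n
    where m = proj₁ (indices k); n = proj₂ (indices k)

  ix iy : ℕ → ℕ
  ix k = proj₁ (indices k)
  iy k = proj₂ (indices k)

  X Y : ℕ → Subset A
  X k = x (ix (suc k))
  Y k = y (iy k)

  ix-step : ∀ k → ix k ≤ ix (suc k)
  ix-step k = ≤-trans (m≤n⊔m _ (ix k)) (n≤1+n _)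

  k≤ix : ∀ k → k ≤ ix k
  k≤ix zero    = z≤n
  k≤ix (suc k) = s≤s (≤-trans (k≤ix k) (m≤n⊔m _ _))

  X-descending : DescendingChain X
  X-descending k = descending-mono x-descending (ix-step (suc k))

  ⋂X⊆∅ : ⋂ ℕ X ⊆ ∅
  ⋂X⊆∅ inAll = ⋂x⊆∅ λ k → descending-mono x-descending (≤-trans (k≤ix k) (ix-step k)) (inAll k)

  Y-ascending : AscendingChain Y
  Y-ascending k = ascending-mono y-ascending (m≤n⊔m _ (iy k))

  separating : SeparatingSequence X Y
  separating = record
    { point   = λ k → witness-point (ix k) (iy k)
    ; point∉X = λ k → witness-∉x-exit (ix k) (iy k) ∘
                  descending-mono x-descending (≤-trans (m≤m⊔n _ (ix k)) (n≤1+n _))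
    ; point∈X = λ k → witness-∈x (ix (suc k)) (iy (suc k))
    ; point∉Y = λ k → witness-∉y (ix k) (iy k)
    ; point∈Y = λ k → ascending-mono y-ascending (m≤m⊔n _ (iy k))
                  (witness-∈y-entry (ix k) (iy k))
    }

module PowersetEmbedding (em : ExcludedMiddle 0ℓ) {A : Set} {W : Pred (Subset A) 0ℓ}
    (pc : IsPrattComonoid A W) (X Y : ℕ → Subset A)
    (W-X : ∀ k → W (X k)) (X-descending : DescendingChain X) (⋂X⊆∅ : ⋂ ℕ X ⊆ ∅)
    (W-Y : ∀ k → W (Y k)) (Y-ascending : AscendingChain Y)
    (separating : SeparatingSequence X Y) where

  open IsPrattComonoid pc using (resp; empty; diag)
  open PrattClosure em pc
  open Classical em
  open SeparatingSequence separating

  Y⟨_⟩ : Subset ℕ → ℕ → Subset A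
  Y⟨ S ⟩ k a = Y k a ⊎ (S k × Y (suc k) a)

  embed : Subset ℕ → Subset A
  embed S = ⋂ ℕ λ k → X k ∪ Y⟨ S ⟩ k

  Y⟨⟩-ascending : ∀ S → AscendingChain Y⟨ S ⟩
  Y⟨⟩-ascending S k (inj₁ y) = inj₁ (Y-ascending k y)
  Y⟨⟩-ascending S k (inj₂ (_ , y)) = inj₁ y

  Y⟨⟩⊆Y : ∀ S k → Y⟨ S ⟩ k ⊆ Y (suc k)
  Y⟨⟩⊆Y S k (inj₁ y) = Y-ascending k y
  Y⟨⟩⊆Y S k (inj₂ (_ , y)) = y

  W-Y⟨⟩ : ∀ S k → W (Y⟨ S ⟩ k)
  W-Y⟨⟩ S k with em {S k}
  ... | yes s = resp ((λ y → inj₂ (s , y)) , Y⟨⟩⊆Y S k) (W-Y (suc k))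
  ... | no ¬s = resp (inj₁ , λ { (inj₁ y) → y ; (inj₂ (s , _)) → ⊥-elim (¬s s) }) (W-Y k)

  W-embed : ∀ S → W (embed S)
  W-embed S = diag (λ a c → ∀ k → X k a ⊎ Y⟨ S ⟩ k c) row column
    where
    row : ∀ a → W (λ c → ∀ k → X k a ⊎ Y⟨ S ⟩ k c)
    row a with ¬∀⇒∃¬ ⋂X⊆∅
    ... | e , a∉Xe = W-⋂-stable _ (λ k → W-const-⊎ _ (W-Y⟨⟩ S k)) e stable
      where
      stable : ∀ {k} → e ≤ k → (λ c → X e a ⊎ Y⟨ S ⟩ e c) ⊆ (λ c → X k a ⊎ Y⟨ S ⟩ k c)
      stable e≤k (inj₁ x) = ⊥-elim (a∉Xe x)
      stable e≤k (inj₂ y) = inj₂ (ascending-mono (Y⟨⟩-ascending S) e≤k y)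
    column : ∀ c → W (λ a → ∀ k → X k a ⊎ Y⟨ S ⟩ k c)
    column c with em {∃ λ j → Y j c}
    ... | yes (j , y) = W-⋂-stable _ (λ k → W-⊎-const (W-X k) _) j stable
      where
      stable : ∀ {k} → j ≤ k → (λ a → X j a ⊎ Y⟨ S ⟩ j c) ⊆ (λ a → X k a ⊎ Y⟨ S ⟩ k c)
      stable j≤k _ = inj₂ (ascending-mono (Y⟨⟩-ascending S) j≤k (inj₁ y))
    ... | no c∉⋃Y = resp ((λ ()) , λ inAll → ⋂X⊆∅ λ k → in-X k (inAll k)) empty
      where
      in-X : ∀ {a} k → X k a ⊎ Y⟨ S ⟩ k c → X k a
      in-X k (inj₁ x) = x
      in-X k (inj₂ y) = ⊥-elim (c∉⋃Y (suc k , Y⟨⟩⊆Y S k y))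

  embed-mono : ∀ {S T} → S ⊆ T → embed S ⊆ embed T
  embed-mono S⊆T inAll k with inAll k
  ... | inj₁ x = inj₁ x
  ... | inj₂ (inj₁ y) = inj₂ (inj₁ y)
  ... | inj₂ (inj₂ (s , y)) = inj₂ (inj₂ (S⊆T s , y))

  embed-critical : ∀ {S a} k → embed S a → ¬ X k a → ¬ Y k a → S k × Y (suc k) a
  embed-critical k inAll ¬x ¬y with inAll k
  ... | inj₁ x = ⊥-elim (¬x x)
  ... | inj₂ (inj₁ y) = ⊥-elim (¬y y)
  ... | inj₂ (inj₂ sy) = sy

  -- Below k the point lies in X, since Y⟨ S ⟩ k′ ⊆ Y k; from k on it lies in Y⟨ T ⟩.
  embed-transfer : ∀ {S T a} k → embed S a → ¬ Y k a → T k → Y (suc k) a → embed T a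
  embed-transfer {S} k inAll ¬y t y k′ with <-cmp k′ k | inAll k′
  ... | tri< k′<k _ _ | inj₁ x = inj₁ x
  ... | tri< k′<k _ _ | inj₂ y′ = ⊥-elim (¬y (ascending-mono Y-ascending k′<k (Y⟨⟩⊆Y S k′ y′)))
  ... | tri≈ _ refl _ | _ = inj₂ (inj₂ (t , y))
  ... | tri> _ _ k<k′ | _ = inj₂ (inj₁ (ascending-mono Y-ascending k<k′ y))

  critical-or-uniform : ∀ a → (∃ λ k → ¬ X k a × ¬ Y k a) ⊎ (∀ k → (X k ∪ Y k) a)
  critical-or-uniform a with em {∀ k → (X k ∪ Y k) a}
  ... | yes uniform = inj₂ uniform
  ... | no ¬uniform with ¬∀⇒∃¬ ¬uniform
  ...   | k , ¬x∪y = inj₁ (k , (λ x → ¬x∪y (inj₁ x)) , (λ y → ¬x∪y (inj₂ y)))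

  uniform⊆embed : ∀ {S a} → (∀ k → (X k ∪ Y k) a) → embed S a
  uniform⊆embed uniform k with uniform k
  ... | inj₁ x = inj₁ x
  ... | inj₂ y = inj₂ (inj₁ y)

  point∈embed : ∀ {S} k → S k → embed S (point k)
  point∈embed {S} k s k′ with <-cmp k′ k
  ... | tri< k′<k _ _ = inj₁ (point∈X-below k′<k)
    where
    point∈X-below : ∀ {k′ k} → k′ < k → X k′ (point k)
    point∈X-below {k = suc j} (s≤s k′≤j) = descending-mono X-descending k′≤j (point∈X j)
  ... | tri≈ _ refl _ = inj₂ (inj₂ (s , point∈Y k))
  ... | tri> _ _ k<k′ = inj₂ (inj₁ (ascending-mono Y-ascending k<k′ (point∈Y k)))

  embed-reflects : ∀ {S T} → embed S ⊆ embed T → S ⊆ T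
  embed-reflects S⊆T {k} s =
    proj₁ (embed-critical k (S⊆T (point∈embed k s)) (point∉X k) (point∉Y k))

  ⋃-embed : (I : Set) → I → (S : I → Subset ℕ) → ⋃ I (λ i → embed (S i)) ≐ embed (⋃ I S)
  ⋃-embed I i₀ S = (λ { (i , a∈) → embed-mono (i ,_) a∈ }) , split
    where
    split : embed (⋃ I S) ⊆ ⋃ I (λ i → embed (S i))
    split {a} a∈ with critical-or-uniform a
    ... | inj₂ uniform = i₀ , uniform⊆embed uniform
    ... | inj₁ (k , ¬x , ¬y) with embed-critical k a∈ ¬x ¬y
    ...   | (i , s) , y = i , embed-transfer k a∈ ¬y s y

  ⋂-embed : (I : Set) → I → (S : I → Subset ℕ) → ⋂ I (λ i → embed (S i)) ≐ embed (⋂ I S)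
  ⋂-embed I i₀ S = merge , λ a∈ i → embed-mono (λ s → s i) a∈
    where
    merge : ⋂ I (λ i → embed (S i)) ⊆ embed (⋂ I S)
    merge {a} a∈ k with em {(X k ∪ Y k) a}
    ... | yes (inj₁ x) = inj₁ x
    ... | yes (inj₂ y) = inj₂ (inj₁ y)
    ... | no ¬x∪y = inj₂ (inj₂ ((λ i → proj₁ (critical i)) , proj₂ (critical i₀)))
      where
      critical : ∀ i → S i k × Y (suc k) a
      critical i = embed-critical k (a∈ i) (λ x → ¬x∪y (inj₁ x)) (λ y → ¬x∪y (inj₂ y))

  Image : Pred (Subset A) (lsuc 0ℓ)
  Image Z = ∃ λ S → Z ≐ embed S

  image-isCompleteSublattice : IsCompleteSublattice W Image
  image-isCompleteSublattice = record
    { sub      = λ { (S , Z≐) → resp (≐-sym Z≐) (W-embed S) }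
    ; ⋃-closed = λ I i₀ F F∈ → _ , ≐-trans (⋃-cong (proj₂ ∘ F∈)) (⋃-embed I i₀ (proj₁ ∘ F∈))
    ; ⋂-closed = λ I i₀ F F∈ → _ , ≐-trans (⋂-cong (proj₂ ∘ F∈)) (⋂-embed I i₀ (proj₁ ∘ F∈))
    }

  image-isoToPowersetω : IsoToPowersetω Image
  image-isoToPowersetω = record
    { f     = embed
    ; into  = λ S → S , ≐-refl
    ; onto  = λ Z Z∈ → Z∈
    ; order = λ S T → mk⇔ embed-mono embed-reflects
    }

proposition7p3 : (lem : ∀ {ℓ : Level} → ExcludedMiddle ℓ) →
    (A : Set) (W : Pred (Subset A) 0ℓ) → IsPrattComonoid A W →
    (x y : ℕ → Subset A) →
    (∀ m → W (x m)) → DescendingChain x →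
    (∀ n → W (y n)) → AscendingChain y →
    ⋂ ℕ x ≐ ∅ →
    (∀ m n → ¬ ((x m ∩ ⋃ ℕ y) ⊆ y n)) →
    Σ (Pred (Subset A) (lsuc 0ℓ)) (λ L → IsCompleteSublattice W L × IsoToPowersetω L)
proposition7p3 lem A W pc x y W-x x-descending W-y y-ascending ⋂x≐∅ x∩⋃y⊈y =
  Image , image-isCompleteSublattice , image-isoToPowersetω
  where
  open Thinning lem x y x-descending y-ascending (proj₁ ⋂x≐∅) x∩⋃y⊈y
  open PowersetEmbedding lem pc X Y (λ k → W-x (ix (suc k))) X-descending ⋂X⊆∅
                                    (λ k → W-y (iy k)) Y-ascending separating
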